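{- Let $\mathbb{V}$ be a vector space of dimension $n\ge 3$ over a finite field $\mathbb{F}$, with a fixed basis $\mathcal{B}$, and let $\mathbb{IG}(\mathbb{V})$ be its nonzero component graph with respect to $\mathcal{B}$. Then $\operatorname{sdim}_M(\mathbb{IG}(\mathbb{V}))=|V(\mathbb{IG}(\mathbb{V}))|-2^{n-1}$.
   Context: Let $\mathcal{B}=\{v_1,\dots,v_n\}$ be a basis of $\mathbb{V}$. For $a=a_1v_1+\dots+a_nv_n$, its skeleton is $S_{\mathcal{B}}(a)=\{v_i\mid a_i\neq0\}$. The nonzero component graph $\mathbb{IG}(\mathbb{V})$ has vertex set $\mathbb{V}\setminus\{0\}$, with distinct $a,b$ adjacent iff $S_{\mathcal{B}}(a)\cap S_{\mathcal{B}}(b)\neq\emptyset$. In a connected graph $G$, a vertex $w$ strongly resolves $u,v$ if some shortest $u$–$w$ path contains $v$ or some shortest $v$–$w$ path contains $u$; $W\subseteq V(G)$ is a strong resolving set if every pair of distinct vertices is strongly resolved by some vertex in $W$; $\operatorname{sdim}_M(G)$ is the minimum size of a strong resolving set. -}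

module Defs where

open import Level using (Level; 0ℓ)
open import Data.Nat using (ℕ; _≤_; _∸_; _^_; _≥_)
open import Data.Fin using (Fin)
open import Data.Vec using (Vec; lookup; replicate)
open import Data.List using (List; []; _∷_; length)
open import Data.List.Relation.Unary.All using (All)
open import Data.List.Relation.Unary.Any using (Any)
open import Data.List.Relation.Unary.Unique.Propositional using (Unique)
open import Data.List.Membership.Propositional using (_∈_)
open import Data.Product using (Σ; ∃; ∃-syntax; _×_; _,_)
open import Data.Sum using (_⊎_)
open import Relation.Nullary using (¬_)
open import Relation.Binary.PropositionalEquality using (_≡_; _≢_)
open import Algebra.Structures using (IsCommutativeRing)
open import Function.Bundles using (_↔_)

record FiniteField : Set₁ where
  field
    Carrier : Set
    _+_ _*_ : Carrier → Carrier → Carrier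
    -_      : Carrier → Carrier
    0# 1#   : Carrier
    isCommutativeRing : IsCommutativeRing _≡_ _+_ _*_ -_ 0# 1#
    0≢1     : 0# ≢ 1#
    inverse : ∀ x → x ≢ 0# → ∃[ y ] (x * y ≡ 1#)
    size    : ℕ
    enum    : Carrier ↔ Fin size

-- The n-dimensional vector space over F with a fixed basis
-- B = {v_1,...,v_n} is represented by coordinate vectors
-- a = a_1 v_1 + ... + a_n v_n  ↦  (a_1,...,a_n) : Vec Carrier n.

module NonzeroComponentGraph (𝔽 : FiniteField) (n : ℕ) where
  open FiniteField 𝔽

  𝕍 : Set
  𝕍 = Vec Carrier n

  zeroV : 𝕍
  zeroV = replicate n 0#

  InSkeleton : Fin n → 𝕍 → Set
  InSkeleton i a = lookup a i ≢ 0#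

  IsVertex : 𝕍 → Set
  IsVertex a = a ≢ zeroV

  Adj : 𝕍 → 𝕍 → Set
  Adj a b = IsVertex a × IsVertex b × a ≢ b × ∃[ i ] (InSkeleton i a × InSkeleton i b)

  data Walk : 𝕍 → 𝕍 → Set where
    [_]  : ∀ {u} → IsVertex u → Walk u u
    _∷ʷ_ : ∀ {u v w} → Adj u v → Walk v w → Walk u w

  verts : ∀ {u w} → Walk u w → List 𝕍
  verts ([_] {u} _) = u ∷ []
  verts (_∷ʷ_ {u} _ p) = u ∷ verts p

  len : ∀ {u w} → Walk u w → ℕ
  len [ _ ]    = 0
  len (_ ∷ʷ p) = Data.Nat.suc (len p)

  Path : 𝕍 → 𝕍 → Set
  Path u w = Σ (Walk u w) (λ p → Unique (verts p))

  ShortestPath : ∀ {u w} → Path u w → Set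
  ShortestPath {u} {w} (p , _) = ∀ (q : Path u w) → len p ≤ len (Data.Product.proj₁ q)

  OnShortestPath : 𝕍 → 𝕍 → 𝕍 → Set
  OnShortestPath u w v = ∃[ P ] (ShortestPath {u} {w} P × v ∈ verts (Data.Product.proj₁ P))

  StronglyResolves : 𝕍 → 𝕍 → 𝕍 → Set
  StronglyResolves w u v = OnShortestPath u w v ⊎ OnShortestPath v w u

  IsStrongResolvingSet : List 𝕍 → Set
  IsStrongResolvingSet W =
    All IsVertex W ×
    (∀ u v → IsVertex u → IsVertex v → u ≢ v → Any (λ w → StronglyResolves w u v) W)

  -- sdim_M(IG(V)) = m  (sets represented by duplicate-free lists)
  SdimIs : ℕ → Set
  SdimIs m =
    (∃[ W ] (Unique W × IsStrongResolvingSet W × length W ≡ m)) ×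
    (∀ W → Unique W → IsStrongResolvingSet W → m ≤ length W)

  -- L enumerates V(IG(V)) exactly once, so |V(IG(V))| = length L
  EnumeratesVertices : List 𝕍 → Set
  EnumeratesVertices L = Unique L × All IsVertex L × (∀ a → IsVertex a → a ∈ L)

{-# OPTIONS --safe #-}
module Submission where

-- Two nonzero vectors are at distance at most 2 (through the all-ones vector), so a
-- vertex w different from u and v strongly resolves them only if one of them is the
-- middle vertex of a path of length 2 from the other to w. Then u and v are adjacent,
-- and they cannot have the same skeleton, since the middle vertex would make the
-- other one adjacent to w. Hence the vertices outside a strong resolving set have
-- distinct and pairwise intersecting skeletons. Such a family contains at most one
-- set from each complementary pair {S, Sᶜ}, so it has at most 2^(n-1) members.
-- Conversely, the 2^(n-1) vectors with first coordinate 1 and all other coordinates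
-- in {0, 1} can be left out: two of them differ in some coordinate i ≥ 1, and the
-- unit vector eᵢ resolves them through the one that is nonzero at i.

open import Defs
open import Data.Bool using (Bool; true; false; not; if_then_else_)
open import Data.Bool.Properties using (not-involutive)
open import Data.Empty using (⊥-elim)
open import Data.Fin using (Fin; zero; suc)
import Data.Fin.Properties as Fin
open import Data.List using (List; []; _∷_; _++_; length; map; filter; cartesianProductWith)
open import Data.List.Properties using (length-map; length-++; length-removeAt′)
open import Data.List.Membership.Propositional using (_∈_; _∉_; _─_; find; lose)
open import Data.List.Membership.Propositional.Properties
  using (∈-map⁻; ∈-filter⁺; ∈-filter⁻; ∈-cartesianProductWith⁺)
open import Data.List.Relation.Binary.Subset.Propositional using (_⊆_)
import Data.List.Relation.Unary.All as All
open import Data.List.Relation.Unary.Any using (Any; here; there; index)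
open import Data.List.Relation.Unary.AllPairs using ([]; _∷_)
open import Data.List.Relation.Unary.Unique.Propositional using (Unique)
import Data.List.Relation.Unary.Unique.Propositional.Properties as Unique
open import Data.Nat using (ℕ; zero; suc; _+_; _*_; _^_; _∸_; _≤_; _≥_; z≤n; s≤s)
open import Data.Nat.Properties
  using (≤-refl; ≤-trans; ≤-antisym; +-suc; +-comm; +-monoˡ-≤; +-monoʳ-≤; m+n∸m≡n; m≤n+o⇒m∸n≤o;
         module ≤-Reasoning)
open import Data.Product using (Σ-syntax; ∃-syntax; _×_; _,_; proj₁; proj₂)
import Data.Product as Product
open import Data.Sum using (_⊎_; inj₁; inj₂)
open import Data.Vec using (Vec; []; _∷_; lookup; replicate; _[_]≔_) renaming (map to vmap)
open import Data.Vec.Properties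
  using (≡-dec; ∷-injective; ∷-injectiveˡ; ∷-injectiveʳ; lookup-map; lookup-replicate;
         lookup∘update; lookup∘update′; map-∘; map-cong; map-id)
import Data.Vec.Relation.Unary.All as VecAll
open import Function using (_∘_; id)
open import Function.Properties.Inverse using (↔⇒↣)
open import Level using (Level)
open import Relation.Binary.Definitions using (DecidableEquality)
open import Relation.Binary.PropositionalEquality
  using (_≡_; _≢_; refl; sym; trans; cong; cong₂; ≢-sym; module ≡-Reasoning)
open import Relation.Nullary using (¬_; Dec; yes; no; ¬?; does; contradiction)
open import Relation.Nullary.Decidable using (_×-dec_; dec-true; dec-false)
open import Relation.Unary using (Pred; Decidable)
open import Relation.Unary.Properties using (∁?)

∈-─ : ∀ {A : Set} {x y : A} {xs} (x∈xs : x ∈ xs) → y ∈ xs → y ≢ x → y ∈ xs ─ x∈xs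
∈-─ (here refl) (here refl) y≢x = ⊥-elim (y≢x refl)
∈-─ (here refl) (there y∈xs) _  = y∈xs
∈-─ (there x∈xs) (here refl) _  = here refl
∈-─ (there x∈xs) (there y∈xs) y≢x = there (∈-─ x∈xs y∈xs y≢x)

injectiveOn⇒length≤ : ∀ {A B : Set} {f : A → B} {xs : List A} {ys : List B} → Unique xs →
                      (∀ {x y} → x ∈ xs → y ∈ xs → f x ≡ f y → x ≡ y) →
                      (∀ {x} → x ∈ xs → f x ∈ ys) → length xs ≤ length ys
injectiveOn⇒length≤ {xs = []} _ _ _ = z≤n
injectiveOn⇒length≤ {f = f} {x ∷ xs} {ys} (x∉xs ∷ xs!) inj f∈ys = begin
  suc (length xs)            ≤⟨ s≤s (injectiveOn⇒length≤ xs! (λ p q → inj (there p) (there q)) f∈ys─fx) ⟩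
  suc (length (ys ─ fx∈ys))  ≡⟨ length-removeAt′ ys (index fx∈ys) ⟨
  length ys                  ∎
  where
  open ≤-Reasoning
  fx∈ys : f x ∈ ys
  fx∈ys = f∈ys (here refl)
  f∈ys─fx : ∀ {y} → y ∈ xs → f y ∈ ys ─ fx∈ys
  f∈ys─fx y∈xs = ∈-─ fx∈ys (f∈ys (there y∈xs))
    (λ fy≡fx → All.lookup x∉xs y∈xs (sym (inj (there y∈xs) (here refl) fy≡fx)))

⊆⇒length≤ : ∀ {A : Set} {xs ys : List A} → Unique xs → xs ⊆ ys → length xs ≤ length ys
⊆⇒length≤ xs! xs⊆ys = injectiveOn⇒length≤ xs! (λ _ _ x≡y → x≡y) xs⊆ys

length-filter-∁ : ∀ {A : Set} {ℓ : Level} {P : Pred A ℓ} (P? : Decidable P) xs →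
                  length (filter P? xs) + length (filter (∁? P?) xs) ≡ length xs
length-filter-∁ P? [] = refl
length-filter-∁ P? (x ∷ xs) with P? x
... | yes _ = cong suc (length-filter-∁ P? xs)
... | no _  = trans (+-suc _ _) (cong suc (length-filter-∁ P? xs))

module _ {A : Set} (_≟_ : DecidableEquality A) where
  open import Data.List.Membership.DecPropositional _≟_ using (_∈?_; _∉?_)

  length≤length+filter-∉ : ∀ {xs} ys → Unique xs →
                           length xs ≤ length ys + length (filter (_∉? ys) xs)
  length≤length+filter-∉ {xs} ys xs! = begin
    length xs                                                   ≡⟨ length-filter-∁ (_∈? ys) xs ⟨
    length (filter (_∈? ys) xs) + length (filter (_∉? ys) xs)  ≤⟨ +-monoˡ-≤ _ filter-∈≤ys ⟩
    length ys + length (filter (_∉? ys) xs)                     ∎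
    where
    open ≤-Reasoning
    filter-∈≤ys : length (filter (_∈? ys) xs) ≤ length ys
    filter-∈≤ys = ⊆⇒length≤ (Unique.filter⁺ (_∈? ys) xs!) (proj₂ ∘ ∈-filter⁻ (_∈? ys) {xs = xs})

  length-filter-∉ : ∀ {xs ys} → Unique xs → Unique ys → ys ⊆ xs →
                    length (filter (_∉? ys) xs) ≡ length xs ∸ length ys
  length-filter-∉ {xs} {ys} xs! ys! ys⊆xs = begin
    length kept                                            ≡⟨ m+n∸m≡n (length ys) (length kept) ⟨
    length ys + length kept ∸ length ys                    ≡⟨ cong (λ k → k + length kept ∸ length ys)
                                                                   filter-∈≡ys ⟨
    length (filter (_∈? ys) xs) + length kept ∸ length ys  ≡⟨ cong (_∸ length ys)
                                                                   (length-filter-∁ (_∈? ys) xs) ⟩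
    length xs ∸ length ys                                  ∎
    where
    open ≡-Reasoning
    kept : List A
    kept = filter (_∉? ys) xs
    filter-∈≡ys : length (filter (_∈? ys) xs) ≡ length ys
    filter-∈≡ys = ≤-antisym
      (⊆⇒length≤ (Unique.filter⁺ (_∈? ys) xs!) (proj₂ ∘ ∈-filter⁻ (_∈? ys) {xs = xs}))
      (⊆⇒length≤ ys! (λ y∈ys → ∈-filter⁺ (_∈? ys) (ys⊆xs y∈ys) y∈ys))

length-cartesianProductWith : ∀ {A B C : Set} (f : A → B → C) xs ys →
                              length (cartesianProductWith f xs ys) ≡ length xs * length ys
length-cartesianProductWith f [] ys = refl
length-cartesianProductWith f (x ∷ xs) ys = begin
  length (map (f x) ys ++ cartesianProductWith f xs ys)          ≡⟨ length-++ (map (f x) ys) ⟩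
  length (map (f x) ys) + length (cartesianProductWith f xs ys)  ≡⟨ cong₂ _+_ (length-map (f x) ys)
                                                                      (length-cartesianProductWith f xs ys) ⟩
  length ys + length xs * length ys                              ∎
  where open ≡-Reasoning

vectors : ∀ {A : Set} → List A → (k : ℕ) → List (Vec A k)
vectors xs zero    = [] ∷ []
vectors xs (suc k) = cartesianProductWith _∷_ xs (vectors xs k)

length-vectors : ∀ {A : Set} (xs : List A) k → length (vectors xs k) ≡ length xs ^ k
length-vectors xs zero    = refl
length-vectors xs (suc k) =
  trans (length-cartesianProductWith _∷_ xs (vectors xs k)) (cong (length xs *_) (length-vectors xs k))

∈-vectors⁺ : ∀ {A : Set} {xs : List A} {k} {v : Vec A k} → VecAll.All (_∈ xs) v → v ∈ vectors xs k
∈-vectors⁺ VecAll.[]         = here refl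
∈-vectors⁺ (x∈xs VecAll.∷ v∈) = ∈-cartesianProductWith⁺ _∷_ x∈xs (∈-vectors⁺ v∈)

vectors⁺ : ∀ {A : Set} {xs : List A} → Unique xs → ∀ k → Unique (vectors xs k)
vectors⁺ xs! zero    = All.[] ∷ []
vectors⁺ xs! (suc k) = Unique.cartesianProductWith⁺ _∷_ ∷-injective xs! (vectors⁺ xs! k)

booleans : List Bool
booleans = true ∷ false ∷ []

∈-booleans : ∀ b → b ∈ booleans
∈-booleans true  = here refl
∈-booleans false = there (here refl)

booleans! : Unique booleans
booleans! = ((λ ()) All.∷ All.[]) ∷ All.[] ∷ []

false≢true : false ≢ true
false≢true ()

map-not-involutive : ∀ {k} (s : Vec Bool k) → vmap not (vmap not s) ≡ s
map-not-involutive s = trans (sym (map-∘ not not s)) (trans (map-cong not-involutive s) (map-id s))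

canonical : ∀ {k} → Vec Bool (suc k) → Vec Bool k
canonical (true  ∷ s) = vmap not s
canonical (false ∷ s) = s

canonical-injective : ∀ {k} (s t : Vec Bool (suc k)) → canonical s ≡ canonical t →
                      s ≡ t ⊎ vmap not s ≡ t
canonical-injective (true ∷ s) (true ∷ t) eq = inj₁ (cong (true ∷_) (begin
  s                      ≡⟨ map-not-involutive s ⟨
  vmap not (vmap not s)  ≡⟨ cong (vmap not) eq ⟩
  vmap not (vmap not t)  ≡⟨ map-not-involutive t ⟩
  t                      ∎))
  where open ≡-Reasoning
canonical-injective (true  ∷ s) (false ∷ t) eq = inj₂ (cong (false ∷_) eq)
canonical-injective (false ∷ s) (true  ∷ t) eq =
  inj₂ (cong (true ∷_) (trans (cong (vmap not) eq) (map-not-involutive t)))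
canonical-injective (false ∷ s) (false ∷ t) eq = inj₁ (cong (false ∷_) eq)

Separates : ∀ {k} → Fin k → Vec Bool k → Vec Bool k → Set
Separates i s t = lookup s i ≡ true × lookup t i ≡ false

Separates⇒≢ : ∀ {k i} {s t : Vec Bool k} → Separates i s t → s ≢ t
Separates⇒≢ (si , ti) refl = false≢true (trans (sym ti) si)

separatingIndex : ∀ {k} (s t : Vec Bool k) → s ≢ t → ∃[ i ] (Separates i s t ⊎ Separates i t s)
separatingIndex []          []          s≢t = ⊥-elim (s≢t refl)
separatingIndex (true  ∷ s) (false ∷ t) _   = zero , inj₁ (refl , refl)
separatingIndex (false ∷ s) (true  ∷ t) _   = zero , inj₂ (refl , refl)
separatingIndex (true  ∷ s) (true  ∷ t) s≢t =
  Product.map suc id (separatingIndex s t (s≢t ∘ cong (true ∷_)))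
separatingIndex (false ∷ s) (false ∷ t) s≢t =
  Product.map suc id (separatingIndex s t (s≢t ∘ cong (false ∷_)))

module StrongMetricDimension (𝔽 : FiniteField) (m : ℕ) where
  open FiniteField 𝔽 using (Carrier; 0#; 1#; 0≢1; enum)
  open NonzeroComponentGraph 𝔽 (suc m)

  _≟_ : DecidableEquality Carrier
  _≟_ = Fin.inj⇒≟ (↔⇒↣ enum)

  _≟ᵛ_ : DecidableEquality 𝕍
  _≟ᵛ_ = ≡-dec _≟_

  1≢0 : 1# ≢ 0#
  1≢0 = ≢-sym 0≢1

  nonzeroCoordinate : ∀ {k} (a : Vec Carrier k) → a ≢ replicate k 0# → ∃[ i ] lookup a i ≢ 0#
  nonzeroCoordinate []      a≢0 = ⊥-elim (a≢0 refl)
  nonzeroCoordinate (x ∷ a) a≢0 with x ≟ 0#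
  ... | no x≢0   = zero , x≢0
  ... | yes refl = Product.map suc id (nonzeroCoordinate a (a≢0 ∘ cong (0# ∷_)))

  InSkeleton⇒IsVertex : ∀ {a} i → InSkeleton i a → IsVertex a
  InSkeleton⇒IsVertex i a≢0 refl = a≢0 (lookup-replicate i 0#)

  Overlap : 𝕍 → 𝕍 → Set
  Overlap u v = ∃[ i ] (InSkeleton i u × InSkeleton i v)

  overlap? : ∀ u v → Dec (Overlap u v)
  overlap? u v = Fin.any? (λ i → ¬? (lookup u i ≟ 0#) ×-dec ¬? (lookup v i ≟ 0#))

  Overlap-sym : ∀ {u v} → Overlap u v → Overlap v u
  Overlap-sym (i , ui , vi) = i , vi , ui

  Adj⇒Overlap : ∀ {u v} → Adj u v → Overlap u v
  Adj⇒Overlap (_ , _ , _ , uv) = uv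

  hub : 𝕍
  hub = replicate (suc m) 1#

  InSkeleton-hub : ∀ i → InSkeleton i hub
  InSkeleton-hub i = 1≢0 ∘ trans (sym (lookup-replicate i 1#))

  hub-isVertex : IsVertex hub
  hub-isVertex = InSkeleton⇒IsVertex zero (InSkeleton-hub zero)

  Overlap-hub : ∀ u → IsVertex u → Overlap u hub
  Overlap-hub u u≢0 with nonzeroCoordinate u u≢0
  ... | i , ui = i , ui , InSkeleton-hub i

  ¬Overlap⇒≢hub : ∀ {u v} → IsVertex v → ¬ Overlap u v → u ≢ hub
  ¬Overlap⇒≢hub {v = v} v≢0 ¬uv refl = ¬uv (Overlap-sym {v} {hub} (Overlap-hub v v≢0))

  edgePath : ∀ {u w} → Adj u w → Path u w
  edgePath uw@(_ , w≢0 , u≢w , _) = uw ∷ʷ [ w≢0 ] , (u≢w All.∷ All.[]) ∷ All.[] ∷ []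

  twoEdgePath : ∀ {u v w} → Adj u v → Adj v w → u ≢ w → Path u w
  twoEdgePath uv@(_ , _ , u≢v , _) vw@(_ , w≢0 , v≢w , _) u≢w =
    uv ∷ʷ (vw ∷ʷ [ w≢0 ]) ,
    (u≢v All.∷ u≢w All.∷ All.[]) ∷ (v≢w All.∷ All.[]) ∷ All.[] ∷ []

  ≢⇒1≤len : ∀ {u w} (p : Walk u w) → u ≢ w → 1 ≤ len p
  ≢⇒1≤len [ _ ]    u≢w = ⊥-elim (u≢w refl)
  ≢⇒1≤len (_ ∷ʷ _) _   = s≤s z≤n

  ¬Overlap⇒2≤len : ∀ {u w} (p : Walk u w) → u ≢ w → ¬ Overlap u w → 2 ≤ len p
  ¬Overlap⇒2≤len [ _ ]             u≢w _   = ⊥-elim (u≢w refl)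
  ¬Overlap⇒2≤len (uw ∷ʷ [ _ ])     _   ¬uw = ⊥-elim (¬uw (Adj⇒Overlap uw))
  ¬Overlap⇒2≤len (_ ∷ʷ (_ ∷ʷ _))   _   _   = s≤s (s≤s z≤n)

  shortestPath : ∀ {u w} → IsVertex u → IsVertex w → u ≢ w →
                 Σ[ P ∈ Path u w ] (ShortestPath P × len (proj₁ P) ≤ 2)
  shortestPath {u} {w} u≢0 w≢0 u≢w with overlap? u w
  ... | yes uw = edgePath (u≢0 , w≢0 , u≢w , uw) , (λ Q → ≢⇒1≤len (proj₁ Q) u≢w) , s≤s z≤n
  ... | no ¬uw =
    twoEdgePath (u≢0 , hub-isVertex , ¬Overlap⇒≢hub w≢0 ¬uw , Overlap-hub u u≢0)
                (hub-isVertex , w≢0 , ≢-sym (¬Overlap⇒≢hub u≢0 (¬uw ∘ Overlap-sym {w} {u})) ,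
                 Overlap-sym {w} {hub} (Overlap-hub w w≢0))
                u≢w ,
    (λ Q → ¬Overlap⇒2≤len (proj₁ Q) u≢w ¬uw) , ≤-refl

  ∈-verts-end : ∀ {u w} (p : Walk u w) → w ∈ verts p
  ∈-verts-end [ _ ]    = here refl
  ∈-verts-end (_ ∷ʷ p) = there (∈-verts-end p)

  OnShortestPath-end : ∀ {u w} → IsVertex u → IsVertex w → u ≢ w → OnShortestPath u w w
  OnShortestPath-end u≢0 w≢0 u≢w with shortestPath u≢0 w≢0 u≢w
  ... | P , P-shortest , _ = P , P-shortest , ∈-verts-end (proj₁ P)

  interiorVertex : ∀ {u v w} (p : Walk u w) → len p ≤ 2 → v ∈ verts p → v ≢ u → v ≢ w →
                   Adj u v × Adj v w × len p ≡ 2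
  interiorVertex [ _ ]                     _ (here refl)                 v≢u _   = ⊥-elim (v≢u refl)
  interiorVertex (_ ∷ʷ [ _ ])              _ (here refl)                 v≢u _   = ⊥-elim (v≢u refl)
  interiorVertex (_ ∷ʷ [ _ ])              _ (there (here refl))         _   v≢w = ⊥-elim (v≢w refl)
  interiorVertex (_ ∷ʷ (_ ∷ʷ [ _ ]))       _ (here refl)                 v≢u _   = ⊥-elim (v≢u refl)
  interiorVertex (uv ∷ʷ (vw ∷ʷ [ _ ]))     _ (there (here refl))         _   _   = uv , vw , refl
  interiorVertex (_ ∷ʷ (_ ∷ʷ [ _ ]))       _ (there (there (here refl))) _   v≢w = ⊥-elim (v≢w refl)
  interiorVertex (_ ∷ʷ (_ ∷ʷ (_ ∷ʷ _)))   (s≤s (s≤s ())) _ _ _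

  OnShortestPath-interior : ∀ {u v w} → IsVertex u → IsVertex w → u ≢ w → v ≢ u → v ≢ w →
                            OnShortestPath u w v → Adj u v × Adj v w × ¬ Overlap u w
  OnShortestPath-interior u≢0 w≢0 u≢w v≢u v≢w (P , P-shortest , v∈P)
    with shortestPath u≢0 w≢0 u≢w
  ... | Q , _ , Q≤2 with interiorVertex (proj₁ P) (≤-trans (P-shortest Q) Q≤2) v∈P v≢u v≢w
  ... | uv , vw , P≡2 = uv , vw , λ uw → 2≰1 P≡2 (P-shortest (edgePath (u≢0 , w≢0 , u≢w , uw)))
    where
    2≰1 : ∀ {k} → k ≡ 2 → ¬ k ≤ 1
    2≰1 refl (s≤s ())

  isNonzero : Carrier → Bool
  isNonzero x = not (does (x ≟ 0#))

  isNonzero-0# : isNonzero 0# ≡ false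
  isNonzero-0# = cong not (dec-true (0# ≟ 0#) refl)

  isNonzero-≢0 : ∀ {x} → x ≢ 0# → isNonzero x ≡ true
  isNonzero-≢0 {x} x≢0 = cong not (dec-false (x ≟ 0#) x≢0)

  skeleton : 𝕍 → Vec Bool (suc m)
  skeleton = vmap isNonzero

  InSkeleton⇒skeleton≡true : ∀ a i → InSkeleton i a → lookup (skeleton a) i ≡ true
  InSkeleton⇒skeleton≡true a i ai≢0 = trans (lookup-map i isNonzero a) (isNonzero-≢0 ai≢0)

  skeleton≡true⇒InSkeleton : ∀ a i → lookup (skeleton a) i ≡ true → InSkeleton i a
  skeleton≡true⇒InSkeleton a i ai≡true ai≡0 = false≢true (begin
    false                  ≡⟨ isNonzero-0# ⟨
    isNonzero 0#           ≡⟨ cong isNonzero ai≡0 ⟨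
    isNonzero (lookup a i) ≡⟨ lookup-map i isNonzero a ⟨
    lookup (skeleton a) i  ≡⟨ ai≡true ⟩
    true                   ∎)
    where open ≡-Reasoning

  Overlap-resp-skeleton : ∀ u u′ v → skeleton u ≡ skeleton u′ → Overlap u v → Overlap u′ v
  Overlap-resp-skeleton u u′ v eq (i , ui , vi) = i , u′i , vi
    where
    u′i : InSkeleton i u′
    u′i = skeleton≡true⇒InSkeleton u′ i
            (trans (cong (λ s → lookup s i) (sym eq)) (InSkeleton⇒skeleton≡true u i ui))

  complement⇒¬Overlap : ∀ u v → vmap not (skeleton u) ≡ skeleton v → ¬ Overlap u v
  complement⇒¬Overlap u v eq (i , ui , vi) = false≢true (begin
    false                              ≡⟨ cong not (InSkeleton⇒skeleton≡true u i ui) ⟨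
    not (lookup (skeleton u) i)        ≡⟨ lookup-map i not (skeleton u) ⟨
    lookup (vmap not (skeleton u)) i   ≡⟨ cong (λ s → lookup s i) eq ⟩
    lookup (skeleton v) i              ≡⟨ InSkeleton⇒skeleton≡true v i vi ⟩
    true                               ∎)
    where open ≡-Reasoning

  resolvedByOther⇒Overlap×skeleton≢ : ∀ {u v w} → IsVertex u → IsVertex v → IsVertex w →
    u ≢ v → w ≢ u → w ≢ v → StronglyResolves w u v → Overlap u v × skeleton u ≢ skeleton v
  resolvedByOther⇒Overlap×skeleton≢ {u} {v} {w} u≢0 v≢0 w≢0 u≢v w≢u w≢v (inj₁ v-between)
    with OnShortestPath-interior u≢0 w≢0 (≢-sym w≢u) (≢-sym u≢v) (≢-sym w≢v) v-between
  ... | uv , vw , ¬uw =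
    Adj⇒Overlap uv , λ eq → ¬uw (Overlap-resp-skeleton v u w (sym eq) (Adj⇒Overlap vw))
  resolvedByOther⇒Overlap×skeleton≢ {u} {v} {w} u≢0 v≢0 w≢0 u≢v w≢u w≢v (inj₂ u-between)
    with OnShortestPath-interior v≢0 w≢0 (≢-sym w≢v) u≢v (≢-sym w≢u) u-between
  ... | vu , uw , ¬vw =
    Overlap-sym {v} {u} (Adj⇒Overlap vu) , λ eq → ¬vw (Overlap-resp-skeleton u v w eq (Adj⇒Overlap uw))

  canonicalSkeleton : 𝕍 → Vec Bool m
  canonicalSkeleton = canonical ∘ skeleton

  resolvedByOther⇒canonicalSkeleton≢ : ∀ {u v w} → IsVertex u → IsVertex v → IsVertex w →
    u ≢ v → w ≢ u → w ≢ v → StronglyResolves w u v → canonicalSkeleton u ≢ canonicalSkeleton v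
  resolvedByOther⇒canonicalSkeleton≢ {u} {v} u≢0 v≢0 w≢0 u≢v w≢u w≢v r eq
    with resolvedByOther⇒Overlap×skeleton≢ u≢0 v≢0 w≢0 u≢v w≢u w≢v r
       | canonical-injective (skeleton u) (skeleton v) eq
  ... | _  , skeleton≢ | inj₁ same       = skeleton≢ same
  ... | uv , _         | inj₂ complement = complement⇒¬Overlap u v complement uv

  open import Data.List.Membership.DecPropositional _≟ᵛ_ using (_∈?_; _∉?_)

  sdim-lowerBound : ∀ L → EnumeratesVertices L → ∀ W → IsStrongResolvingSet W →
                    length L ∸ 2 ^ m ≤ length W
  sdim-lowerBound L (L! , L-vertices , _) W (W-vertices , W-resolves) =
    m≤n+o⇒m∸n≤o (length L) (2 ^ m) (begin
      length L                   ≤⟨ length≤length+filter-∉ _≟ᵛ_ W L! ⟩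
      length W + length outside  ≤⟨ +-monoʳ-≤ (length W) outside≤2^m ⟩
      length W + 2 ^ m           ≡⟨ +-comm (length W) (2 ^ m) ⟩
      2 ^ m + length W           ∎)
    where
    open ≤-Reasoning
    outside : List 𝕍
    outside = filter (_∉? W) L

    outside⇒vertex∉W : ∀ {x} → x ∈ outside → IsVertex x × x ∉ W
    outside⇒vertex∉W x∈ with ∈-filter⁻ (_∉? W) {xs = L} x∈
    ... | x∈L , x∉W = All.lookup L-vertices x∈L , x∉W

    injective : ∀ {x y} → x ∈ outside → y ∈ outside →
                canonicalSkeleton x ≡ canonicalSkeleton y → x ≡ y
    injective {x} {y} x∈ y∈ eq with x ≟ᵛ y | outside⇒vertex∉W x∈ | outside⇒vertex∉W y∈
    ... | yes x≡y | _ | _ = x≡y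
    ... | no x≢y | x≢0 , x∉W | y≢0 , y∉W with find (W-resolves x y x≢0 y≢0 x≢y)
    ...   | w , w∈W , r = contradiction eq
      (resolvedByOther⇒canonicalSkeleton≢ x≢0 y≢0 (All.lookup W-vertices w∈W) x≢y
        (λ { refl → x∉W w∈W }) (λ { refl → y∉W w∈W }) r)

    outside≤2^m : length outside ≤ 2 ^ m
    outside≤2^m = begin
      length outside               ≤⟨ injectiveOn⇒length≤ (Unique.filter⁺ (_∉? W) L!) injective
                                        (λ _ → ∈-vectors⁺ (VecAll.universal ∈-booleans _)) ⟩
      length (vectors booleans m)  ≡⟨ length-vectors booleans m ⟩
      2 ^ m                        ∎

  indicator : Bool → Carrier
  indicator b = if b then 1# else 0#

  isNonzero∘indicator : ∀ b → isNonzero (indicator b) ≡ b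
  isNonzero∘indicator true  = isNonzero-≢0 1≢0
  isNonzero∘indicator false = isNonzero-0#

  binaryVertex : Vec Bool m → 𝕍
  binaryVertex s = 1# ∷ vmap indicator s

  skeleton-binaryVertex : ∀ s → skeleton (binaryVertex s) ≡ true ∷ s
  skeleton-binaryVertex s = cong₂ _∷_ (isNonzero-≢0 1≢0) (begin
    vmap isNonzero (vmap indicator s) ≡⟨ map-∘ isNonzero indicator s ⟨
    vmap (isNonzero ∘ indicator) s    ≡⟨ map-cong isNonzero∘indicator s ⟩
    vmap id s                         ≡⟨ map-id s ⟩
    s                                 ∎)
    where open ≡-Reasoning

  binaryVertex-injective : ∀ {s t} → binaryVertex s ≡ binaryVertex t → s ≡ t
  binaryVertex-injective {s} {t} eq = ∷-injectiveʳ (begin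
    true ∷ s                   ≡⟨ skeleton-binaryVertex s ⟨
    skeleton (binaryVertex s)  ≡⟨ cong skeleton eq ⟩
    skeleton (binaryVertex t)  ≡⟨ skeleton-binaryVertex t ⟩
    true ∷ t                   ∎)
    where open ≡-Reasoning

  InSkeleton-binaryVertex : ∀ s i → lookup s i ≡ true → InSkeleton (suc i) (binaryVertex s)
  InSkeleton-binaryVertex s i si = skeleton≡true⇒InSkeleton (binaryVertex s) (suc i)
    (trans (cong (λ z → lookup z (suc i)) (skeleton-binaryVertex s)) si)

  InSkeleton-binaryVertex⁻ : ∀ s i → InSkeleton (suc i) (binaryVertex s) → lookup s i ≡ true
  InSkeleton-binaryVertex⁻ s i si = trans (sym (cong (λ z → lookup z (suc i)) (skeleton-binaryVertex s)))
    (InSkeleton⇒skeleton≡true (binaryVertex s) (suc i) si)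
  binaryVertex-isVertex : ∀ s → IsVertex (binaryVertex s)
  binaryVertex-isVertex s = InSkeleton⇒IsVertex zero 1≢0

  binaryVertices : List 𝕍
  binaryVertices = map binaryVertex (vectors booleans m)

  binaryVertices! : Unique binaryVertices
  binaryVertices! = Unique.map⁺ binaryVertex-injective (vectors⁺ booleans! m)

  length-binaryVertices : length binaryVertices ≡ 2 ^ m
  length-binaryVertices =
    trans (length-map binaryVertex (vectors booleans m)) (length-vectors booleans m)

  unit : Fin (suc m) → 𝕍
  unit i = zeroV [ i ]≔ 1#

  InSkeleton-unit : ∀ i → InSkeleton i (unit i)
  InSkeleton-unit i = 1≢0 ∘ trans (sym (lookup∘update i zeroV 1#))

  unit-isVertex : ∀ i → IsVertex (unit i)
  unit-isVertex i = InSkeleton⇒IsVertex i (InSkeleton-unit i)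

  InSkeleton-unit⇒≡ : ∀ i j → InSkeleton j (unit i) → j ≡ i
  InSkeleton-unit⇒≡ i j uj with j Fin.≟ i
  ... | yes j≡i = j≡i
  ... | no j≢i  = ⊥-elim (uj (trans (lookup∘update′ j≢i zeroV 1#) (lookup-replicate j 0#)))

  binaryVertex≢unit : ∀ s i → binaryVertex s ≢ unit (suc i)
  binaryVertex≢unit s i = 1≢0 ∘ ∷-injectiveˡ

  unit∉binaryVertices : ∀ i → unit (suc i) ∉ binaryVertices
  unit∉binaryVertices i u∈ with ∈-map⁻ binaryVertex u∈
  ... | s , _ , eq = binaryVertex≢unit s i (sym eq)

  unit-resolves : ∀ {i s t} → Separates i s t →
                  OnShortestPath (binaryVertex t) (unit (suc i)) (binaryVertex s)
  unit-resolves {i} {s} {t} s-over-t@(si , ti) =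
    twoEdgePath ts se t≢e , (λ Q → ¬Overlap⇒2≤len (proj₁ Q) t≢e ¬te) , there (here refl)
    where
    t≢e : binaryVertex t ≢ unit (suc i)
    t≢e = binaryVertex≢unit t i
    ts : Adj (binaryVertex t) (binaryVertex s)
    ts = binaryVertex-isVertex t , binaryVertex-isVertex s ,
         Separates⇒≢ s-over-t ∘ sym ∘ binaryVertex-injective , zero , 1≢0 , 1≢0
    se : Adj (binaryVertex s) (unit (suc i))
    se = binaryVertex-isVertex s , unit-isVertex (suc i) ,
         binaryVertex≢unit s i , suc i , InSkeleton-binaryVertex s i si , InSkeleton-unit (suc i)
    ¬te : ¬ Overlap (binaryVertex t) (unit (suc i))
    ¬te (j , tj , ej) with InSkeleton-unit⇒≡ (suc i) j ej
    ... | refl = false≢true (trans (sym ti) (InSkeleton-binaryVertex⁻ t i tj))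

  binaryVertices-resolved : ∀ {u v} → u ∈ binaryVertices → v ∈ binaryVertices → u ≢ v →
                            ∃[ i ] StronglyResolves (unit (suc i)) u v
  binaryVertices-resolved u∈ v∈ u≢v with ∈-map⁻ binaryVertex u∈ | ∈-map⁻ binaryVertex v∈
  ... | s , _ , refl | t , _ , refl with separatingIndex s t (u≢v ∘ cong binaryVertex)
  ...   | i , inj₁ s-over-t = i , inj₂ (unit-resolves s-over-t)
  ...   | i , inj₂ t-over-s = i , inj₁ (unit-resolves t-over-s)

  sdim-upperBound : ∀ L → EnumeratesVertices L →
                    ∃[ W ] (Unique W × IsStrongResolvingSet W × length W ≡ length L ∸ 2 ^ m)
  sdim-upperBound L (L! , L-vertices , L-complete) =
    W , Unique.filter⁺ (_∉? binaryVertices) L! , (W-vertices , W-resolves) , length-W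
    where
    W : List 𝕍
    W = filter (_∉? binaryVertices) L

    ∈W : ∀ {x} → IsVertex x → x ∉ binaryVertices → x ∈ W
    ∈W x≢0 x∉ = ∈-filter⁺ (_∉? binaryVertices) (L-complete _ x≢0) x∉

    W-vertices : All.All IsVertex W
    W-vertices = All.tabulate (All.lookup L-vertices ∘ proj₁ ∘ ∈-filter⁻ (_∉? binaryVertices))

    W-resolves : ∀ u v → IsVertex u → IsVertex v → u ≢ v → Any (λ w → StronglyResolves w u v) W
    W-resolves u v u≢0 v≢0 u≢v with u ∈? binaryVertices | v ∈? binaryVertices
    ... | no u∉ | _     = lose (∈W u≢0 u∉) (inj₂ (OnShortestPath-end v≢0 u≢0 (≢-sym u≢v)))
    ... | yes _ | no v∉ = lose (∈W v≢0 v∉) (inj₁ (OnShortestPath-end u≢0 v≢0 u≢v))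
    ... | yes u∈ | yes v∈ with binaryVertices-resolved u∈ v∈ u≢v
    ...   | i , r = lose (∈W (unit-isVertex (suc i)) (unit∉binaryVertices i)) r

    binaryVertices⊆L : binaryVertices ⊆ L
    binaryVertices⊆L b∈ with ∈-map⁻ binaryVertex b∈
    ... | s , _ , refl = L-complete _ (binaryVertex-isVertex s)

    length-W : length W ≡ length L ∸ 2 ^ m
    length-W = trans (length-filter-∉ _≟ᵛ_ L! binaryVertices! binaryVertices⊆L)
                     (cong (length L ∸_) length-binaryVertices)

  sdim : ∀ L → EnumeratesVertices L → SdimIs (length L ∸ 2 ^ m)
  sdim L L-enumerates = sdim-upperBound L L-enumerates , λ W _ → sdim-lowerBound L L-enumerates W

theorem4p16 : (𝔽 : FiniteField) (n : ℕ) → n ≥ 3 →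
              (L : List (Vec (FiniteField.Carrier 𝔽) n)) →
              NonzeroComponentGraph.EnumeratesVertices 𝔽 n L →
              NonzeroComponentGraph.SdimIs 𝔽 n (length L ∸ 2 ^ (n ∸ 1))
-- The hypothesis n ≥ 3 only rules out n = 0; the argument works for every n ≥ 1.
theorem4p16 𝔽 (suc m) _ L L-enumerates = StrongMetricDimension.sdim 𝔽 m L L-enumerates
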